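{- Let $p,q\in\mathbb{Q}[\xi]$. Then there is a unique pair $(P,Q)$ of polynomials in $\mathbb{Q}[\xi]$ with $P'=p$ and $P+Q'-\xi Q=q$. Moreover: - if $p$ and $q$ have opposite parities, then so do $P$ and $Q$, with $P$ having the parity of $q$ and $Q$ having the parity of $p$; - if $p\ne0$ has leading coefficient $r$ and $\deg q\le\deg p$, then $\deg P=\deg Q+1=\deg p+1$, and the leading coefficients of both $P$ and $Q$ equal $\frac{r}{\deg P}$. -}

module Defs where

open import Data.Nat using (ℕ; zero; suc; _≤_; _<_; _⊔_; _*_; s≤s; z≤n)
open import Data.Nat.Properties using (≤-trans; m≤m⊔n; m≤n⊔m; n≤1+n)
open import Data.Integer using (+_)
open import Data.Rational using (ℚ; 0ℚ; _/_) renaming (_+_ to _+ℚ_; _-_ to _-ℚ_; _*_ to _*ℚ_)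
open import Data.Rational.Properties using (*-zeroʳ; +-identityʳ)
open import Relation.Binary.PropositionalEquality using (_≡_; refl; cong₂; trans)
open import Relation.Nullary using (¬_)

-- Polynomials in ℚ[ξ]: coefficient sequences (coefficient of ξ^n at index n)
-- that vanish from some index on.
record Poly : Set where
  field
    coeff  : ℕ → ℚ
    bound  : ℕ
    vanish : ∀ n → bound ≤ n → coeff n ≡ 0ℚ
open Poly public

_≈ₚ_ : Poly → Poly → Set
P ≈ₚ Q = ∀ n → coeff P n ≡ coeff Q n

ℕ→ℚ : ℕ → ℚ
ℕ→ℚ n = + n / 1

deriv : Poly → Poly
deriv P = record
  { coeff  = λ n → ℕ→ℚ (suc n) *ℚ coeff P (suc n)
  ; bound  = bound P
  ; vanish = λ n b≤n → trans (cong₂ _*ℚ_ (refl {x = ℕ→ℚ (suc n)}) (vanish P (suc n) (≤-trans b≤n (n≤1+n n)))) (*-zeroʳ (ℕ→ℚ (suc n)))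
  }

ξ* : Poly → Poly
ξ* P = record
  { coeff  = c
  ; bound  = suc (bound P)
  ; vanish = v
  }
  where
  c : ℕ → ℚ
  c zero    = 0ℚ
  c (suc n) = coeff P n
  v : ∀ n → suc (bound P) ≤ n → c n ≡ 0ℚ
  v (suc n) (s≤s b≤n) = vanish P n b≤n

_+ₚ_ : Poly → Poly → Poly
P +ₚ Q = record
  { coeff  = λ n → coeff P n +ℚ coeff Q n
  ; bound  = bound P ⊔ bound Q
  ; vanish = λ n b≤n → trans (cong₂ _+ℚ_ (vanish P n (≤-trans (m≤m⊔n _ _) b≤n))
                                         (vanish Q n (≤-trans (m≤n⊔m _ _) b≤n)))
                             (+-identityʳ 0ℚ)
  }

_-ₚ_ : Poly → Poly → Poly
P -ₚ Q = record
  { coeff  = λ n → coeff P n -ℚ coeff Q n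
  ; bound  = bound P ⊔ bound Q
  ; vanish = λ n b≤n → trans (cong₂ _-ℚ_ (vanish P n (≤-trans (m≤m⊔n _ _) b≤n))
                                         (vanish Q n (≤-trans (m≤n⊔m _ _) b≤n)))
                             (+-identityʳ 0ℚ)
  }

IsZero : Poly → Set
IsZero P = ∀ n → coeff P n ≡ 0ℚ

Even : Poly → Set
Even P = ∀ n → coeff P (suc (2 * n)) ≡ 0ℚ

Odd : Poly → Set
Odd P = ∀ n → coeff P (2 * n) ≡ 0ℚ

DegLE : Poly → ℕ → Set
DegLE P d = ∀ n → d < n → coeff P n ≡ 0ℚ

HasDeg : Poly → ℕ → Set
HasDeg P d = (¬ coeff P d ≡ 0ℚ) × DegLE P d
  where open import Data.Product using (_×_)

Solves : Poly → Poly → Poly → Poly → Set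
Solves p q P Q = (deriv P ≈ₚ p) × (((P +ₚ deriv Q) -ₚ ξ* Q) ≈ₚ q)
  where open import Data.Product using (_×_)

-- Comparing coefficients, P' = p fixes every coefficient of P except the constant one,
-- and P + Q' − ξ Q = q becomes the backward recurrence Q(m) = P(m+1) − q(m+1) + (m+2) Q(m+2)
-- together with P(0) = q(0) − Q(1). Since Q must vanish eventually, the recurrence determines Q
-- from the top down. It links only indices of equal parity, and when deg q ≤ deg p = d its
-- inhomogeneous term vanishes above d, so Q has degree d with Q(d) = P(d+1) = p(d)/(d+1).
module Submission where

open import Defs
open import Data.Nat using (ℕ; suc; zero; _⊔_; _≤_; _<_; s≤s) renaming (_+_ to _+ℕ_; _*_ to _*ℕ_)
open import Data.Integer using (+_)
open import Data.Rational using (ℚ; mkℚ; _/_; 0ℚ; 1ℚ) renaming (_*_ to _*ℚ_; _+_ to _+ℚ_; _-_ to _-ℚ_)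
open import Data.Product using (Σ-syntax; _×_; _,_)
open import Relation.Binary.PropositionalEquality
open import Relation.Nullary using (¬_)
import Data.Rational.Properties as ℚP
import Data.Nat.Properties as ℕP
import Data.Nat.Coprimality as Coprime
open import Data.Rational.Solver using (module +-*-Solver)
open +-*-Solver using (solve; _:+_; _:-_; _:*_; _:=_; con)

_÷suc_ : ℚ → ℕ → ℚ
x ÷suc n = x *ℚ (+ 1 / suc n)

-- Both factors normalise to reduced fractions, with numerator and denominator swapped.
suc*1/suc≡1 : ∀ n → ℕ→ℚ (suc n) *ℚ (+ 1 / suc n) ≡ 1ℚ
suc*1/suc≡1 n = trans (cong₂ _*ℚ_ (ℚP.normalize-coprime suc⊥1) (ℚP.normalize-coprime 1⊥suc))
                      (ℚP.*-inverseʳ (mkℚ (+ suc n) 0 suc⊥1))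
  where
  1⊥suc : Coprime.Coprime 1 (suc n)
  1⊥suc = Coprime.1-coprimeTo (suc n)
  suc⊥1 : Coprime.Coprime (suc n) 1
  suc⊥1 = Coprime.sym 1⊥suc

suc*÷suc : ∀ n x → ℕ→ℚ (suc n) *ℚ (x ÷suc n) ≡ x
suc*÷suc n x = begin
  s *ℚ (x *ℚ u) ≡⟨ solve 3 (λ s x u → s :* (x :* u) := x :* (s :* u)) refl s x u ⟩
  x *ℚ (s *ℚ u) ≡⟨ cong (x *ℚ_) (suc*1/suc≡1 n) ⟩
  x *ℚ 1ℚ       ≡⟨ ℚP.*-identityʳ x ⟩
  x             ∎
  where
  open ≡-Reasoning
  s u : ℚ
  s = ℕ→ℚ (suc n)
  u = + 1 / suc n

suc*-÷suc : ∀ n y → (ℕ→ℚ (suc n) *ℚ y) ÷suc n ≡ y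
suc*-÷suc n y = begin
  (s *ℚ y) *ℚ u ≡⟨ solve 3 (λ s y u → (s :* y) :* u := y :* (s :* u)) refl s y u ⟩
  y *ℚ (s *ℚ u) ≡⟨ cong (y *ℚ_) (suc*1/suc≡1 n) ⟩
  y *ℚ 1ℚ       ≡⟨ ℚP.*-identityʳ y ⟩
  y             ∎
  where
  open ≡-Reasoning
  s u : ℚ
  s = ℕ→ℚ (suc n)
  u = + 1 / suc n

suc*≡⇒≡÷suc : ∀ n {x y} → ℕ→ℚ (suc n) *ℚ y ≡ x → y ≡ x ÷suc n
suc*≡⇒≡÷suc n {y = y} eq = trans (sym (suc*-÷suc n y)) (cong (_÷suc n) eq)

0÷suc : ∀ n → 0ℚ ÷suc n ≡ 0ℚ
0÷suc n = ℚP.*-zeroˡ (+ 1 / suc n)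

÷suc-nonZero : ∀ n {x} → ¬ x ≡ 0ℚ → ¬ x ÷suc n ≡ 0ℚ
÷suc-nonZero n {x} x≢0 x÷≡0 =
  x≢0 (trans (sym (suc*÷suc n x)) (trans (cong (ℕ→ℚ (suc n) *ℚ_) x÷≡0) (ℚP.*-zeroʳ (ℕ→ℚ (suc n)))))

m+2[1+k]≡2+m+2k : ∀ m k → m +ℕ 2 *ℕ suc k ≡ suc (suc m) +ℕ 2 *ℕ k
m+2[1+k]≡2+m+2k m k = begin
  m +ℕ 2 *ℕ suc k            ≡⟨ cong (m +ℕ_) (ℕP.*-suc 2 k) ⟩
  m +ℕ suc (suc (2 *ℕ k))    ≡⟨ ℕP.+-suc m (suc (2 *ℕ k)) ⟩
  suc (m +ℕ suc (2 *ℕ k))    ≡⟨ cong suc (ℕP.+-suc m (2 *ℕ k)) ⟩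
  suc (suc m) +ℕ 2 *ℕ k      ∎
  where open ≡-Reasoning

r+2n+2j≡r+2[n+j] : ∀ r n j → (r +ℕ 2 *ℕ n) +ℕ 2 *ℕ j ≡ r +ℕ 2 *ℕ (n +ℕ j)
r+2n+2j≡r+2[n+j] r n j =
  trans (ℕP.+-assoc r (2 *ℕ n) (2 *ℕ j)) (cong (r +ℕ_) (sym (ℕP.*-distribˡ-+ 2 n j)))

m≤m+2k : ∀ m k → m ≤ m +ℕ 2 *ℕ k
m≤m+2k m k = ℕP.m≤m+n m (2 *ℕ k)

k≤m+2k : ∀ m k → k ≤ m +ℕ 2 *ℕ k
k≤m+2k m k = ℕP.≤-trans (ℕP.m≤m+n k (k +ℕ 0)) (ℕP.m≤n+m (2 *ℕ k) m)

EventuallyZero : (ℕ → ℚ) → Set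
EventuallyZero g = Σ[ B ∈ ℕ ] (∀ m → B ≤ m → g m ≡ 0ℚ)

module BackwardRecurrence (f c : ℕ → ℚ) where

  Satisfies : (ℕ → ℚ) → Set
  Satisfies g = ∀ m → g m ≡ f m +ℚ c m *ℚ g (suc (suc m))

  unfold : ℕ → ℕ → ℚ
  unfold zero    m = 0ℚ
  unfold (suc k) m = f m +ℚ c m *ℚ unfold k (suc (suc m))

  unfold-vanishes : ∀ k m → (∀ j → f (m +ℕ 2 *ℕ j) ≡ 0ℚ) → unfold k m ≡ 0ℚ
  unfold-vanishes zero    m f≡0 = refl
  unfold-vanishes (suc k) m f≡0 = begin
    f m +ℚ c m *ℚ unfold k (suc (suc m)) ≡⟨ cong₂ (λ a b → a +ℚ c m *ℚ b) f[m]≡0 rest≡0 ⟩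
    0ℚ +ℚ c m *ℚ 0ℚ                      ≡⟨ cong (0ℚ +ℚ_) (ℚP.*-zeroʳ (c m)) ⟩
    0ℚ                                   ∎
    where
    open ≡-Reasoning
    f[m]≡0 : f m ≡ 0ℚ
    f[m]≡0 = subst (λ i → f i ≡ 0ℚ) (ℕP.+-identityʳ m) (f≡0 0)
    rest≡0 : unfold k (suc (suc m)) ≡ 0ℚ
    rest≡0 = unfold-vanishes k (suc (suc m))
      (λ j → subst (λ i → f i ≡ 0ℚ) (m+2[1+k]≡2+m+2k m j) (f≡0 (suc j)))

  satisfies-unique : ∀ {g h} → Satisfies g → Satisfies h →
                     EventuallyZero g → EventuallyZero h → ∀ m → g m ≡ h m
  satisfies-unique {g} {h} g-sat h-sat (Bg , g≡0) (Bh , h≡0) m = agree D m (k≤m+2k m D)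
    where
    D : ℕ
    D = Bg ⊔ Bh
    agree : ∀ k m → D ≤ m +ℕ 2 *ℕ k → g m ≡ h m
    agree zero    m D≤m+0 = trans (g≡0 m (ℕP.≤-trans (ℕP.m≤m⊔n Bg Bh) D≤m))
                                  (sym (h≡0 m (ℕP.≤-trans (ℕP.m≤n⊔m Bg Bh) D≤m)))
      where
      D≤m : D ≤ m
      D≤m = subst (D ≤_) (ℕP.+-identityʳ m) D≤m+0
    agree (suc k) m D≤ = begin
      g m                                   ≡⟨ g-sat m ⟩
      f m +ℚ c m *ℚ g (suc (suc m))         ≡⟨ cong (λ t → f m +ℚ c m *ℚ t) (agree k (suc (suc m))
                                                  (subst (D ≤_) (m+2[1+k]≡2+m+2k m k) D≤)) ⟩
      f m +ℚ c m *ℚ h (suc (suc m))         ≡⟨ sym (h-sat m) ⟩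
      h m                                   ∎
      where open ≡-Reasoning

  module _ (B : ℕ) (f≡0 : ∀ m → B ≤ m → f m ≡ 0ℚ) where

    unfold-stable : ∀ k m → B ≤ m +ℕ 2 *ℕ k → unfold (suc k) m ≡ unfold k m
    unfold-stable zero    m B≤m+0 = begin
      f m +ℚ c m *ℚ 0ℚ ≡⟨ cong₂ _+ℚ_ (f≡0 m (subst (B ≤_) (ℕP.+-identityʳ m) B≤m+0)) (ℚP.*-zeroʳ (c m)) ⟩
      0ℚ +ℚ 0ℚ         ≡⟨⟩
      0ℚ               ∎
      where open ≡-Reasoning
    unfold-stable (suc k) m B≤ = cong (λ t → f m +ℚ c m *ℚ t)
      (unfold-stable k (suc (suc m)) (subst (B ≤_) (m+2[1+k]≡2+m+2k m k) B≤))

    -- unfold k m no longer depends on k once B ≤ m + 2k, and k = suc B achieves this for every m.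
    solution : ℕ → ℚ
    solution = unfold (suc B)

    solution-satisfies : Satisfies solution
    solution-satisfies m = cong (λ t → f m +ℚ c m *ℚ t)
      (sym (unfold-stable B (suc (suc m)) (k≤m+2k (suc (suc m)) B)))

    solution-vanishes-along : ∀ m → (∀ j → f (m +ℕ 2 *ℕ j) ≡ 0ℚ) → solution m ≡ 0ℚ
    solution-vanishes-along = unfold-vanishes (suc B)

    solution-vanishes : ∀ m → B ≤ m → solution m ≡ 0ℚ
    solution-vanishes m B≤m =
      solution-vanishes-along m (λ j → f≡0 _ (ℕP.≤-trans B≤m (m≤m+2k m j)))

    solution-vanishes-on-progression : ∀ r → (∀ i → f (r +ℕ 2 *ℕ i) ≡ 0ℚ) →
                                       ∀ n → solution (r +ℕ 2 *ℕ n) ≡ 0ℚ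
    solution-vanishes-on-progression r f≡0 n = solution-vanishes-along _
      (λ j → subst (λ i → f i ≡ 0ℚ) (sym (r+2n+2j≡r+2[n+j] r n j)) (f≡0 (n +ℕ j)))

antideriv : ℚ → Poly → Poly
antideriv c p = record { coeff = a ; bound = suc (bound p) ; vanish = a-vanish }
  where
  a : ℕ → ℚ
  a zero    = c
  a (suc n) = coeff p n ÷suc n
  a-vanish : ∀ n → suc (bound p) ≤ n → a n ≡ 0ℚ
  a-vanish (suc n) (s≤s b≤n) = trans (cong (_÷suc n) (vanish p n b≤n)) (0÷suc n)

deriv-antideriv : ∀ c p → deriv (antideriv c p) ≈ₚ p
deriv-antideriv c p n = suc*÷suc n (coeff p n)

deriv≈⇒coeff-suc : ∀ {P p} → deriv P ≈ₚ p → ∀ n → coeff P (suc n) ≡ coeff p n ÷suc n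
deriv≈⇒coeff-suc P'≈p n = suc*≡⇒≡÷suc n (P'≈p n)

deriv≈⇒≈antideriv : ∀ {P p c} → deriv P ≈ₚ p → coeff P 0 ≡ c → P ≈ₚ antideriv c p
deriv≈⇒≈antideriv P'≈p P₀≡c zero    = P₀≡c
deriv≈⇒≈antideriv {P} {p} P'≈p P₀≡c (suc n) = deriv≈⇒coeff-suc {P} {p} P'≈p n

antideriv-even : ∀ c p → Odd p → Even (antideriv c p)
antideriv-even c p p-odd n = trans (cong (_÷suc (2 *ℕ n)) (p-odd n)) (0÷suc (2 *ℕ n))

antideriv-odd : ∀ c p → c ≡ 0ℚ → Even p → Odd (antideriv c p)
antideriv-odd c p c≡0 p-even zero    = c≡0
antideriv-odd c p c≡0 p-even (suc n) = subst (λ i → coeff (antideriv c p) i ≡ 0ℚ)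
  (sym (ℕP.*-suc 2 n)) (trans (cong (_÷suc (suc (2 *ℕ n))) (p-even n)) (0÷suc (suc (2 *ℕ n))))

antideriv-hasDeg : ∀ c p {d} → HasDeg p d → HasDeg (antideriv c p) (suc d)
antideriv-hasDeg c p {d} (p[d]≢0 , p-deg) = ÷suc-nonZero d p[d]≢0 , deg≤
  where
  deg≤ : DegLE (antideriv c p) (suc d)
  deg≤ (suc n) (s≤s d<n) = trans (cong (_÷suc n) (p-deg n d<n)) (0÷suc n)

coeff₀-equation⇒ : ∀ P Q {w} → coeff ((P +ₚ deriv Q) -ₚ ξ* Q) 0 ≡ w →
                   coeff P 0 ≡ w -ℚ ℕ→ℚ 1 *ℚ coeff Q 1
coeff₀-equation⇒ P Q eq = trans (solve 2 (λ x y → x := ((x :+ y) :- con 0ℚ) :- y) refl x y) (cong (_-ℚ y) eq)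
  where
  x y : ℚ
  x = coeff P 0
  y = ℕ→ℚ 1 *ℚ coeff Q 1

coeff₀-equation⇐ : ∀ P Q {w} → coeff P 0 ≡ w -ℚ ℕ→ℚ 1 *ℚ coeff Q 1 →
                   coeff ((P +ₚ deriv Q) -ₚ ξ* Q) 0 ≡ w
coeff₀-equation⇐ P Q {w} eq = trans (cong (λ x → (x +ℚ y) -ℚ 0ℚ) eq)
                                    (solve 2 (λ w y → ((w :- y) :+ y) :- con 0ℚ := w) refl w y)
  where
  y : ℚ
  y = ℕ→ℚ 1 *ℚ coeff Q 1

coeff-suc-equation⇒ : ∀ P Q m {w} → coeff ((P +ₚ deriv Q) -ₚ ξ* Q) (suc m) ≡ w →
                      coeff Q m ≡ (coeff P (suc m) -ℚ w) +ℚ ℕ→ℚ (suc (suc m)) *ℚ coeff Q (suc (suc m))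
coeff-suc-equation⇒ P Q m eq =
  trans (solve 3 (λ x y z → z := (x :- ((x :+ y) :- z)) :+ y) refl x y (coeff Q m))
        (cong (λ t → (x -ℚ t) +ℚ y) eq)
  where
  x y : ℚ
  x = coeff P (suc m)
  y = ℕ→ℚ (suc (suc m)) *ℚ coeff Q (suc (suc m))

coeff-suc-equation⇐ : ∀ P Q m {w} →
                      coeff Q m ≡ (coeff P (suc m) -ℚ w) +ℚ ℕ→ℚ (suc (suc m)) *ℚ coeff Q (suc (suc m)) →
                      coeff ((P +ₚ deriv Q) -ₚ ξ* Q) (suc m) ≡ w
coeff-suc-equation⇐ P Q m {w} eq =
  trans (cong (λ z → (x +ℚ y) -ℚ z) eq) (solve 3 (λ x y w → (x :+ y) :- ((x :- w) :+ y) := w) refl x y w)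
  where
  x y : ℚ
  x = coeff P (suc m)
  y = ℕ→ℚ (suc (suc m)) *ℚ coeff Q (suc (suc m))

module Solution (p q : Poly) where

  -- inhom m = P(m+1) − q(m+1), with P(m+1) = p(m)/(m+1) already forced by P' = p.
  inhom : ℕ → ℚ
  inhom m = coeff p m ÷suc m -ℚ coeff q (suc m)

  weight : ℕ → ℚ
  weight m = ℕ→ℚ (suc (suc m))

  open BackwardRecurrence inhom weight

  inhom-vanishes-at : ∀ m → coeff p m ≡ 0ℚ → coeff q (suc m) ≡ 0ℚ → inhom m ≡ 0ℚ
  inhom-vanishes-at m p≡0 q≡0 = cong₂ _-ℚ_ (trans (cong (_÷suc m) p≡0) (0÷suc m)) q≡0

  B : ℕ
  B = bound p ⊔ bound q

  inhom-vanishes : ∀ m → B ≤ m → inhom m ≡ 0ℚ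
  inhom-vanishes m B≤m = inhom-vanishes-at m
    (vanish p m (ℕP.≤-trans (ℕP.m≤m⊔n (bound p) (bound q)) B≤m))
    (vanish q (suc m) (ℕP.m≤n⇒m≤1+n (ℕP.≤-trans (ℕP.m≤n⊔m (bound p) (bound q)) B≤m)))

  Q : Poly
  Q = record { coeff = solution B inhom-vanishes ; bound = B ; vanish = solution-vanishes B inhom-vanishes }

  P : Poly
  P = antideriv (coeff q 0 -ℚ ℕ→ℚ 1 *ℚ coeff Q 1) p

  solves : Solves p q P Q
  solves = deriv-antideriv (coeff P 0) p , equation
    where
    equation : ((P +ₚ deriv Q) -ₚ ξ* Q) ≈ₚ q
    equation zero    = coeff₀-equation⇐ P Q refl
    equation (suc m) = coeff-suc-equation⇐ P Q m (solution-satisfies B inhom-vanishes m)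

  unique : ∀ P₁ Q₁ → Solves p q P₁ Q₁ → (P₁ ≈ₚ P) × (Q₁ ≈ₚ Q)
  unique P₁ Q₁ (P₁'≈p , equation) = P₁≈P , Q₁≈Q
    where
    Q₁-satisfies : Satisfies (coeff Q₁)
    Q₁-satisfies m = trans (coeff-suc-equation⇒ P₁ Q₁ m (equation (suc m)))
      (cong (λ x → (x -ℚ coeff q (suc m)) +ℚ weight m *ℚ coeff Q₁ (suc (suc m)))
            (deriv≈⇒coeff-suc {P₁} {p} P₁'≈p m))
    Q₁≈Q : Q₁ ≈ₚ Q
    Q₁≈Q = satisfies-unique Q₁-satisfies (solution-satisfies B inhom-vanishes)
      (bound Q₁ , vanish Q₁) (B , solution-vanishes B inhom-vanishes)
    P₁≈P : P₁ ≈ₚ P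
    P₁≈P = deriv≈⇒≈antideriv {P₁} {p} P₁'≈p
      (trans (coeff₀-equation⇒ P₁ Q₁ (equation zero)) (cong (λ y → coeff q 0 -ℚ ℕ→ℚ 1 *ℚ y) (Q₁≈Q 1)))

  even-odd : Even p × Odd q → Odd P × Even Q
  even-odd (p-even , q-odd) = antideriv-odd (coeff P 0) p P₀≡0 p-even , Q-even
    where
    q-odd-suc : ∀ i → coeff q (suc (suc (2 *ℕ i))) ≡ 0ℚ
    q-odd-suc i = subst (λ n → coeff q n ≡ 0ℚ) (ℕP.*-suc 2 i) (q-odd (suc i))
    Q-even : Even Q
    Q-even = solution-vanishes-on-progression B inhom-vanishes 1
      (λ i → inhom-vanishes-at (suc (2 *ℕ i)) (p-even i) (q-odd-suc i))
    P₀≡0 : coeff q 0 -ℚ ℕ→ℚ 1 *ℚ coeff Q 1 ≡ 0ℚ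
    P₀≡0 = cong₂ (λ a b → a -ℚ ℕ→ℚ 1 *ℚ b) (q-odd 0) (Q-even 0)

  odd-even : Odd p × Even q → Even P × Odd Q
  odd-even (p-odd , q-even) = antideriv-even (coeff P 0) p p-odd , Q-odd
    where
    Q-odd : Odd Q
    Q-odd = solution-vanishes-on-progression B inhom-vanishes 0
      (λ i → inhom-vanishes-at (2 *ℕ i) (p-odd i) (q-even i))

  degrees : ∀ d → HasDeg p d → DegLE q d →
            HasDeg P (suc d) × HasDeg Q d × coeff Q d ≡ coeff P (suc d)
  degrees d p-hasDeg@(p[d]≢0 , p-deg) q-deg =
    antideriv-hasDeg (coeff P 0) p p-hasDeg , (Q[d]≢0 , Q-deg) , Q[d]≡P[1+d]
    where
    inhom-above : ∀ m → d < m → inhom m ≡ 0ℚ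
    inhom-above m d<m = inhom-vanishes-at m (p-deg m d<m) (q-deg (suc m) (ℕP.m≤n⇒m≤1+n d<m))
    Q-deg : DegLE Q d
    Q-deg m d<m = solution-vanishes-along B inhom-vanishes m
      (λ j → inhom-above (m +ℕ 2 *ℕ j) (ℕP.≤-trans d<m (m≤m+2k m j)))
    Q[d]≡P[1+d] : coeff Q d ≡ coeff P (suc d)
    Q[d]≡P[1+d] = begin
      coeff Q d
        ≡⟨ solution-satisfies B inhom-vanishes d ⟩
      (x -ℚ coeff q (suc d)) +ℚ weight d *ℚ coeff Q (suc (suc d))
        ≡⟨ cong₂ (λ a b → (x -ℚ a) +ℚ weight d *ℚ b) (q-deg (suc d) ℕP.≤-refl) (Q-deg (suc (suc d)) (ℕP.n≤1+n _)) ⟩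
      (x -ℚ 0ℚ) +ℚ weight d *ℚ 0ℚ
        ≡⟨ solve 2 (λ x w → (x :- con 0ℚ) :+ w :* con 0ℚ := x) refl x (weight d) ⟩
      x ∎
      where
      open ≡-Reasoning
      x : ℚ
      x = coeff p d ÷suc d
    Q[d]≢0 : ¬ coeff Q d ≡ 0ℚ
    Q[d]≢0 = subst (λ a → ¬ a ≡ 0ℚ) (sym Q[d]≡P[1+d]) (÷suc-nonZero d p[d]≢0)

lemma3p1 : (p q : Poly) →
    Σ[ P ∈ Poly ] Σ[ Q ∈ Poly ]
      ( Solves p q P Q
      × (∀ P₁ Q₁ → Solves p q P₁ Q₁ → (P₁ ≈ₚ P) × (Q₁ ≈ₚ Q))
      × ((Even p × Odd q → Odd P × Even Q) × (Odd p × Even q → Even P × Odd Q))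
      × (∀ (d : ℕ) (r : ℚ) → HasDeg p d → coeff p d ≡ r → DegLE q d →
           HasDeg P (suc d) × HasDeg Q d
           × coeff P (suc d) ≡ r *ℚ (+ 1 / suc d)
           × coeff Q d ≡ r *ℚ (+ 1 / suc d)) )
lemma3p1 p q = P , Q , solves , unique , (even-odd , odd-even) , leading
  where
  open Solution p q
  leading : ∀ d r → HasDeg p d → coeff p d ≡ r → DegLE q d →
            HasDeg P (suc d) × HasDeg Q d × coeff P (suc d) ≡ r ÷suc d × coeff Q d ≡ r ÷suc d
  leading d r p-deg p[d]≡r q-deg =
    let P-deg , Q-deg , Q[d]≡P[1+d] = degrees d p-deg q-deg
        P[1+d]≡r÷ : coeff P (suc d) ≡ r ÷suc d
        P[1+d]≡r÷ = cong (_÷suc d) p[d]≡r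
    in  P-deg , Q-deg , P[1+d]≡r÷ , trans Q[d]≡P[1+d] P[1+d]≡r÷
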